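{- Let $G$ be a forbidden induced subgraph for the class of apex cographs with $|V(G)|=9$, and let $S,T,F\subseteq V(G)$ be sets each inducing a path $P_4$ in $G$ with $|S\cap T|=|T\cap F|=|S\cap F|=1$. Write $S\cap T=\{\alpha\}$, $S\cap F=\{\beta\}$, $T\cap F=\{\gamma\}$, and $S=\{\alpha,s_1,s_2,\beta\}$, $T=\{\alpha,t_1,t_2,\gamma\}$, $F=\{\beta,f_1,f_2,\gamma\}$. Let $\{x,y\}$ be any one of $\{\alpha,f_1\}$, $\{\alpha,f_2\}$, $\{\beta,t_1\}$, $\{\beta,t_2\}$, $\{\gamma,s_1\}$, $\{\gamma,s_2\}$. Then $G-\{x,y\}$ is a cograph.
   Context: All graphs are finite, simple and undirected; $G[X]$ is the subgraph induced on $X$, and $P_4$ is the path on four vertices. A cograph is a graph generated from $K_1$ by complementation and disjoint union; equivalently, a graph with no induced $P_4$. A graph $G$ is an apex cograph if it has a vertex $v$ with $G-v$ a cograph. A forbidden induced subgraph for apex cographs is a graph that is not an apex cograph but all of whose proper induced subgraphs are apex cographs. (Under the hypotheses, $S\cap T\cap F=\emptyset$, so $\alpha,\beta,\gamma,s_1,s_2,t_1,t_2,f_1,f_2$ are the nine distinct vertices of $G$.) -}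

module Defs where

open import Data.Nat using (ℕ)
open import Data.Bool using (Bool; true; false)
open import Data.Fin using (Fin)
open import Data.Fin.Subset using (Subset; ⁅_⁆; _∪_; _─_; _-_; _⊆_; _⊂_; _∈_; ⊤; Empty)
open import Data.Product using (Σ; Σ-syntax; _×_)
open import Data.Sum using (_⊎_)
open import Relation.Nullary using (¬_)
open import Relation.Binary.PropositionalEquality using (_≡_; _≢_)

record Graph (n : ℕ) : Set where
  field
    adj    : Fin n → Fin n → Bool
    sym    : ∀ i j → adj i j ≡ adj j i
    irrefl : ∀ i → adj i i ≡ false

open Graph public

Edge : ∀ {n} → Graph n → Fin n → Fin n → Set
Edge G i j = adj G i j ≡ true

NonEdge : ∀ {n} → Graph n → Fin n → Fin n → Set
NonEdge G i j = adj G i j ≡ false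

InducesP4 : ∀ {n} → Graph n → Subset n → Set
InducesP4 {n} G X =
  Σ[ a ∈ Fin n ] Σ[ b ∈ Fin n ] Σ[ c ∈ Fin n ] Σ[ d ∈ Fin n ]
    ( a ≢ b × a ≢ c × a ≢ d × b ≢ c × b ≢ d × c ≢ d
    × X ≡ ⁅ a ⁆ ∪ ⁅ b ⁆ ∪ ⁅ c ⁆ ∪ ⁅ d ⁆
    × Edge G a b × Edge G b c × Edge G c d
    × NonEdge G a c × NonEdge G b d × NonEdge G a d )

CographOn : ∀ {n} → Graph n → Subset n → Set
CographOn G W = ∀ X → X ⊆ W → ¬ InducesP4 G X

-- G[W] is an apex cograph: some vertex v of G[W] has G[W] - v a cograph.
-- (The null graph, W empty, is counted as an apex cograph.)
ApexCographOn : ∀ {n} → Graph n → Subset n → Set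
ApexCographOn {n} G W = Empty W ⊎ (Σ[ v ∈ Fin n ] (v ∈ W × CographOn G (W - v)))

ForbiddenApexCograph : ∀ {n} → Graph n → Set
ForbiddenApexCograph {n} G =
  ¬ ApexCographOn G ⊤ × (∀ (X : Subset n) → X ⊂ ⊤ → ApexCographOn G X)

CographMinus2 : ∀ {n} → Graph n → Fin n → Fin n → Set
CographMinus2 G x y = CographOn G (⊤ ─ (⁅ x ⁆ ∪ ⁅ y ⁆))

-- Deleting a vertex y from G leaves a proper induced subgraph, hence an apex
-- cograph with some apex v, and v lies on every induced P4 of G that avoids y.
-- If y avoids two P4s P and Q meeting only in x, then v = x, so
-- G - {x, y} = (G - y) - x is a cograph. For the pair {α, f₁}: f₁ lies on F but
-- is neither β nor γ (the four listed vertices of a P4 are distinct, by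
-- counting), so f₁ avoids S and T, which meet only in α; the other five pairs
-- are symmetric.
module Submission where

open import Defs hiding (sym)
open import Data.Nat using (ℕ; suc; _≤_; _<_; z≤n; s≤s)
open import Data.Nat.Properties using (≤-trans; ≤-reflexive; ≤-pred; 1+n≰n)
open import Data.Fin using (Fin; zero; suc)
open import Data.Fin.Subset
  using (Subset; ⁅_⁆; _∪_; _∩_; _-_; _─_; _∈_; _∉_; _⊆_; ⊤; ⊥; Nonempty; ∣_∣; inside; outside)
open import Data.Fin.Subset.Properties
  using ( x∈⁅x⁆; x∈⁅y⁆⇒x≡y; x∈p∪q⁺; x∈p∪q⁻; x∈p∩q⁺; ∩-comm; ∪-identityˡ; ∪-identityʳ
        ; q⊆p∪q; ∉⊥; p⊆q⇒∣p∣≤∣q∣; p⊂q⇒∣p∣<∣q∣; ∣p∣≤∣x∷p∣; ∣⊥∣≡0; _∈?_; ∈⊤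
        ; x∈p∧x≢y⇒x∈p-y; x∈p⇒p-x⊂p; p─x─y≡p─y─x; p─q─r≡p─q∪r )
open import Data.List using (List; []; _∷_; length)
open import Data.List.Relation.Unary.All using (All; []; _∷_)
open import Data.List.Relation.Unary.AllPairs using ([]; _∷_)
open import Data.List.Relation.Unary.Any using (here; there)
open import Data.List.Relation.Unary.Unique.Propositional using (Unique)
import Data.List.Membership.Propositional as List
open import Data.Vec using (_∷_)
open import Data.Product using (_×_; _,_)
open import Data.Sum using (inj₁; inj₂)
open import Function using (_∘_)
open import Relation.Nullary using (yes; no; contradiction)
open import Relation.Binary.PropositionalEquality
  using (_≡_; _≢_; refl; sym; trans; cong; subst; module ≡-Reasoning)

private
  variable
    n : ℕ
    x y : Fin n
    p q : Subset n

⋃⁅_⁆ : List (Fin n) → Subset n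
⋃⁅ []     ⁆ = ⊥
⋃⁅ x ∷ xs ⁆ = ⁅ x ⁆ ∪ ⋃⁅ xs ⁆

⁅p⁆∪⁅q⁆∪⁅r⁆∪⁅s⁆≡⋃⁅pqrs⁆ : ∀ {p q r s : Fin n} →
  ⁅ p ⁆ ∪ ⁅ q ⁆ ∪ ⁅ r ⁆ ∪ ⁅ s ⁆ ≡ ⋃⁅ p ∷ q ∷ r ∷ s ∷ [] ⁆
⁅p⁆∪⁅q⁆∪⁅r⁆∪⁅s⁆≡⋃⁅pqrs⁆ {p = p} {q} {r} {s} =
  cong (λ z → ⁅ p ⁆ ∪ ⁅ q ⁆ ∪ ⁅ r ⁆ ∪ z) (sym (∪-identityʳ ⁅ s ⁆))

x∈xs⇒x∈⋃⁅xs⁆ : ∀ {xs} → x List.∈ xs → x ∈ ⋃⁅ xs ⁆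
x∈xs⇒x∈⋃⁅xs⁆ {x = x} (here refl) = x∈p∪q⁺ (inj₁ (x∈⁅x⁆ x))
x∈xs⇒x∈⋃⁅xs⁆ (there x∈xs)        = x∈p∪q⁺ (inj₂ (x∈xs⇒x∈⋃⁅xs⁆ x∈xs))

All≢⇒x∉⋃⁅xs⁆ : ∀ {xs} → All (x ≢_) xs → x ∉ ⋃⁅ xs ⁆
All≢⇒x∉⋃⁅xs⁆ []                   = ∉⊥
All≢⇒x∉⋃⁅xs⁆ {xs = y ∷ _} (x≢y ∷ x≢ys) x∈ with x∈p∪q⁻ ⁅ y ⁆ _ x∈
... | inj₁ x∈⁅y⁆ = x≢y (x∈⁅y⁆⇒x≡y y x∈⁅y⁆)
... | inj₂ x∈ys  = All≢⇒x∉⋃⁅xs⁆ x≢ys x∈ys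

x∉⋃⁅xs⁆⇒All≢ : ∀ xs → x ∉ ⋃⁅ xs ⁆ → All (x ≢_) xs
x∉⋃⁅xs⁆⇒All≢ []       _  = []
x∉⋃⁅xs⁆⇒All≢ (y ∷ ys) x∉ =
  (λ { refl → x∉ (x∈xs⇒x∈⋃⁅xs⁆ {xs = y ∷ ys} (here refl)) })
  ∷ x∉⋃⁅xs⁆⇒All≢ ys (x∉ ∘ q⊆p∪q ⁅ y ⁆ ⋃⁅ ys ⁆)

∣⁅x⁆∪p∣≤1+∣p∣ : ∀ (x : Fin n) p → ∣ ⁅ x ⁆ ∪ p ∣ ≤ suc ∣ p ∣
∣⁅x⁆∪p∣≤1+∣p∣ zero    (s ∷ p) rewrite ∪-identityˡ p = s≤s (∣p∣≤∣x∷p∣ s p)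
∣⁅x⁆∪p∣≤1+∣p∣ (suc x) (outside ∷ p) = ∣⁅x⁆∪p∣≤1+∣p∣ x p
∣⁅x⁆∪p∣≤1+∣p∣ (suc x) (inside  ∷ p) = s≤s (∣⁅x⁆∪p∣≤1+∣p∣ x p)

x∈p⇒∣⁅x⁆∪p∣≤∣p∣ : x ∈ p → ∣ ⁅ x ⁆ ∪ p ∣ ≤ ∣ p ∣
x∈p⇒∣⁅x⁆∪p∣≤∣p∣ {x = x} {p = p} x∈p = p⊆q⇒∣p∣≤∣q∣ ⁅x⁆∪p⊆p
  where
  ⁅x⁆∪p⊆p : ⁅ x ⁆ ∪ p ⊆ p
  ⁅x⁆∪p⊆p z∈ with x∈p∪q⁻ ⁅ x ⁆ p z∈
  ... | inj₁ z∈⁅x⁆ = subst (_∈ p) (sym (x∈⁅y⁆⇒x≡y x z∈⁅x⁆)) x∈p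
  ... | inj₂ z∈p   = z∈p

x∉p⇒∣p∣<∣⁅x⁆∪p∣ : x ∉ p → ∣ p ∣ < ∣ ⁅ x ⁆ ∪ p ∣
x∉p⇒∣p∣<∣⁅x⁆∪p∣ {x = x} {p = p} x∉p =
  p⊂q⇒∣p∣<∣q∣ (q⊆p∪q ⁅ x ⁆ p , x , x∈p∪q⁺ (inj₁ (x∈⁅x⁆ x)) , x∉p)

∣⋃⁅xs⁆∣≤length : ∀ (xs : List (Fin n)) → ∣ ⋃⁅ xs ⁆ ∣ ≤ length xs
∣⋃⁅xs⁆∣≤length {n} []       = ≤-reflexive (∣⊥∣≡0 n)
∣⋃⁅xs⁆∣≤length     (x ∷ xs) = ≤-trans (∣⁅x⁆∪p∣≤1+∣p∣ x _) (s≤s (∣⋃⁅xs⁆∣≤length xs))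

Unique⇒length≤∣⋃⁅xs⁆∣ : ∀ {xs : List (Fin n)} → Unique xs → length xs ≤ ∣ ⋃⁅ xs ⁆ ∣
Unique⇒length≤∣⋃⁅xs⁆∣ []            = z≤n
Unique⇒length≤∣⋃⁅xs⁆∣ (x≢xs ∷ uxs) =
  ≤-trans (s≤s (Unique⇒length≤∣⋃⁅xs⁆∣ uxs)) (x∉p⇒∣p∣<∣⁅x⁆∪p∣ (All≢⇒x∉⋃⁅xs⁆ x≢xs))

length≤∣⋃⁅xs⁆∣⇒Unique : ∀ (xs : List (Fin n)) → length xs ≤ ∣ ⋃⁅ xs ⁆ ∣ → Unique xs
length≤∣⋃⁅xs⁆∣⇒Unique []       _ = []
length≤∣⋃⁅xs⁆∣⇒Unique (x ∷ xs) ≤∣⋃⁅x∷xs⁆∣ =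
  x∉⋃⁅xs⁆⇒All≢ xs x∉
  ∷ length≤∣⋃⁅xs⁆∣⇒Unique xs (≤-pred (≤-trans ≤∣⋃⁅x∷xs⁆∣ (∣⁅x⁆∪p∣≤1+∣p∣ x _)))
  where
  x∉ : x ∉ ⋃⁅ xs ⁆
  x∉ x∈ = 1+n≰n (≤-trans ≤∣⋃⁅x∷xs⁆∣ (≤-trans (x∈p⇒∣⁅x⁆∪p∣≤∣p∣ x∈) (∣⋃⁅xs⁆∣≤length xs)))

p⊆q∧x∉p⇒p⊆q-x : p ⊆ q → x ∉ p → p ⊆ q - x
p⊆q∧x∉p⇒p⊆q-x p⊆q x∉p z∈p = x∈p∧x≢y⇒x∈p-y (p⊆q z∈p) λ { refl → x∉p z∈p }

x∈q∧x≢y⇒x∉p : p ∩ q ≡ ⁅ y ⁆ → x ∈ q → x ≢ y → x ∉ p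
x∈q∧x≢y⇒x∉p {y = y} p∩q≡⁅y⁆ x∈q x≢y x∈p =
  x≢y (x∈⁅y⁆⇒x≡y y (subst (_ ∈_) p∩q≡⁅y⁆ (x∈p∩q⁺ (x∈p , x∈q))))

module _ {n} (G : Graph n) where

  InducesP4⇒4≤∣X∣ : ∀ {X} → InducesP4 G X → 4 ≤ ∣ X ∣
  InducesP4⇒4≤∣X∣ (a , b , c , d , a≢b , a≢c , a≢d , b≢c , b≢d , c≢d , X≡ , _) =
    subst (λ Z → 4 ≤ ∣ Z ∣) (sym (trans X≡ ⁅p⁆∪⁅q⁆∪⁅r⁆∪⁅s⁆≡⋃⁅pqrs⁆))
      (Unique⇒length≤∣⋃⁅xs⁆∣
        ((a≢b ∷ a≢c ∷ a≢d ∷ []) ∷ (b≢c ∷ b≢d ∷ []) ∷ (c≢d ∷ []) ∷ [] ∷ []))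

  InducesP4⇒Nonempty : ∀ {X} → InducesP4 G X → Nonempty X
  InducesP4⇒Nonempty (a , b , c , d , _ , _ , _ , _ , _ , _ , X≡ , _) =
    a , subst (a ∈_) (sym X≡) (x∈p∪q⁺ (inj₁ (x∈⁅x⁆ a)))

  apex-∈-InducesP4 : ∀ {W Z v} → CographOn G (W - v) → InducesP4 G Z → Z ⊆ W → v ∈ Z
  apex-∈-InducesP4 {Z = Z} {v} cograph Z₄ Z⊆W with v ∈? Z
  ... | yes v∈Z = v∈Z
  ... | no  v∉Z = contradiction Z₄ (cograph Z (p⊆q∧x∉p⇒p⊆q-x Z⊆W v∉Z))

  forbidden⇒CographMinus2 : ∀ {P Q} → ForbiddenApexCograph G → InducesP4 G P → InducesP4 G Q →
    P ∩ Q ≡ ⁅ x ⁆ → y ∉ P → y ∉ Q → CographMinus2 G x y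
  forbidden⇒CographMinus2 {x = x} {y} (_ , proper) P₄ Q₄ P∩Q≡⁅x⁆ y∉P y∉Q
    with proper (⊤ - y) (x∈p⇒p-x⊂p ∈⊤)
  ... | inj₁ ⊤-y-empty =
    let a , a∈P = InducesP4⇒Nonempty P₄
    in contradiction (a , p⊆q∧x∉p⇒p⊆q-x (λ _ → ∈⊤) y∉P a∈P) ⊤-y-empty
  ... | inj₂ (v , _ , cograph) = subst (CographOn G) ⊤-y-v≡⊤─⁅x⁆∪⁅y⁆ cograph
    where
    ⊆⊤-y : ∀ {Z} → y ∉ Z → Z ⊆ ⊤ - y
    ⊆⊤-y = p⊆q∧x∉p⇒p⊆q-x (λ _ → ∈⊤)

    v≡x : v ≡ x
    v≡x = x∈⁅y⁆⇒x≡y x (subst (v ∈_) P∩Q≡⁅x⁆ (x∈p∩q⁺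
      (apex-∈-InducesP4 cograph P₄ (⊆⊤-y y∉P) , apex-∈-InducesP4 cograph Q₄ (⊆⊤-y y∉Q))))

    ⊤-y-v≡⊤─⁅x⁆∪⁅y⁆ : ⊤ - y - v ≡ ⊤ ─ (⁅ x ⁆ ∪ ⁅ y ⁆)
    ⊤-y-v≡⊤─⁅x⁆∪⁅y⁆ = begin
      ⊤ - y - v            ≡⟨ cong (⊤ - y -_) v≡x ⟩
      ⊤ - y - x            ≡⟨ p─x─y≡p─y─x ⊤ y x ⟩
      ⊤ - x - y            ≡⟨ p─q─r≡p─q∪r ⊤ ⁅ x ⁆ ⁅ y ⁆ ⟩
      ⊤ ─ (⁅ x ⁆ ∪ ⁅ y ⁆)  ∎
      where open ≡-Reasoning

  forbidden⇒CographMinus2-inner : ∀ {P Q R p q r s} → ForbiddenApexCograph G →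
    InducesP4 G P → InducesP4 G Q → InducesP4 G R →
    P ∩ Q ≡ ⁅ x ⁆ → P ∩ R ≡ ⁅ p ⁆ → Q ∩ R ≡ ⁅ s ⁆ → R ≡ ⋃⁅ p ∷ q ∷ r ∷ s ∷ [] ⁆ →
    CographMinus2 G x q × CographMinus2 G x r
  forbidden⇒CographMinus2-inner {x = x} {R = R} {p} {q} {r} {s}
    forb P₄ Q₄ R₄ P∩Q≡⁅x⁆ P∩R≡⁅p⁆ Q∩R≡⁅s⁆ R≡
    with length≤∣⋃⁅xs⁆∣⇒Unique (p ∷ q ∷ r ∷ s ∷ [])
           (subst (λ Z → 4 ≤ ∣ Z ∣) R≡ (InducesP4⇒4≤∣X∣ R₄))
  ... | (p≢q ∷ p≢r ∷ _ ∷ []) ∷ (_ ∷ q≢s ∷ []) ∷ (r≢s ∷ []) ∷ [] ∷ [] =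
    inner (there (here refl)) (p≢q ∘ sym) q≢s , inner (there (there (here refl))) (p≢r ∘ sym) r≢s
    where
    inner : ∀ {w} → w List.∈ p ∷ q ∷ r ∷ s ∷ [] → w ≢ p → w ≢ s → CographMinus2 G x w
    inner w∈ w≢p w≢s = forbidden⇒CographMinus2 forb P₄ Q₄ P∩Q≡⁅x⁆
      (x∈q∧x≢y⇒x∉p P∩R≡⁅p⁆ w∈R w≢p) (x∈q∧x≢y⇒x∉p Q∩R≡⁅s⁆ w∈R w≢s)
      where
      w∈R : _ ∈ R
      w∈R = subst (_ ∈_) (sym R≡) (x∈xs⇒x∈⋃⁅xs⁆ w∈)

lemma3p3 : (G : Graph 9) → ForbiddenApexCograph G →
    (S T F : Subset 9) → InducesP4 G S → InducesP4 G T → InducesP4 G F →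
    (α β γ s₁ s₂ t₁ t₂ f₁ f₂ : Fin 9) →
    S ∩ T ≡ ⁅ α ⁆ → S ∩ F ≡ ⁅ β ⁆ → T ∩ F ≡ ⁅ γ ⁆ →
    S ≡ ⁅ α ⁆ ∪ ⁅ s₁ ⁆ ∪ ⁅ s₂ ⁆ ∪ ⁅ β ⁆ →
    T ≡ ⁅ α ⁆ ∪ ⁅ t₁ ⁆ ∪ ⁅ t₂ ⁆ ∪ ⁅ γ ⁆ →
    F ≡ ⁅ β ⁆ ∪ ⁅ f₁ ⁆ ∪ ⁅ f₂ ⁆ ∪ ⁅ γ ⁆ →
    CographMinus2 G α f₁ × CographMinus2 G α f₂
    × CographMinus2 G β t₁ × CographMinus2 G β t₂
    × CographMinus2 G γ s₁ × CographMinus2 G γ s₂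
lemma3p3 G forb S T F S₄ T₄ F₄ α β γ s₁ s₂ t₁ t₂ f₁ f₂ S∩T≡⁅α⁆ S∩F≡⁅β⁆ T∩F≡⁅γ⁆ S≡ T≡ F≡ =
  let α-f₁ , α-f₂ = forbidden⇒CographMinus2-inner G forb S₄ T₄ F₄
        S∩T≡⁅α⁆ S∩F≡⁅β⁆ T∩F≡⁅γ⁆
        (trans F≡ ⁅p⁆∪⁅q⁆∪⁅r⁆∪⁅s⁆≡⋃⁅pqrs⁆)
      β-t₁ , β-t₂ = forbidden⇒CographMinus2-inner G forb S₄ F₄ T₄
        S∩F≡⁅β⁆ S∩T≡⁅α⁆ (trans (∩-comm F T) T∩F≡⁅γ⁆)
        (trans T≡ ⁅p⁆∪⁅q⁆∪⁅r⁆∪⁅s⁆≡⋃⁅pqrs⁆)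
      γ-s₁ , γ-s₂ = forbidden⇒CographMinus2-inner G forb T₄ F₄ S₄
        T∩F≡⁅γ⁆ (trans (∩-comm T S) S∩T≡⁅α⁆) (trans (∩-comm F S) S∩F≡⁅β⁆)
        (trans S≡ ⁅p⁆∪⁅q⁆∪⁅r⁆∪⁅s⁆≡⋃⁅pqrs⁆)
  in α-f₁ , α-f₂ , β-t₁ , β-t₂ , γ-s₁ , γ-s₂
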